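{- There exist two equivalent CNF formulae $F$ and $F'$ and a clause $c$ with $c \in F$ and $c \in F'$ such that $c$ is superredundant in $F$ but superirredundant in $F'$.
   Context: A CNF formula is a finite set of clauses; a clause is a finite set of literals, read as their disjunction. Tautological clauses are not allowed in formulae. Resolution: from clauses $c_1 \vee l$ and $c_2 \vee \neg l$ derive $c_1 \vee c_2$; two clauses whose resolvent would be a tautology are considered not to resolve. The resolution closure $\mathrm{ResCn}(F)$ is the set of all clauses obtainable from $F$ by zero or more resolution steps. A clause $c \in F$ is superredundant in $F$ if $\mathrm{ResCn}(F) \setminus \{c\} \models c$, and superirredundant otherwise. -}

module Defs where

open import Data.Nat using (ℕ)
open import Data.Bool using (Bool; true; false; T; not)
open import Data.List using (List)
open import Data.List.Membership.Propositional using (_∈_)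
open import Data.List.Relation.Unary.All using (All)
open import Data.List.Relation.Unary.Any using (Any)
open import Data.Product using (Σ; _×_; ∃)
open import Data.Sum using (_⊎_)
open import Relation.Nullary using (¬_)
open import Relation.Binary.PropositionalEquality using (_≡_; _≢_)
open import Function.Bundles using (_⇔_)

data Lit : Set where
  pos : ℕ → Lit
  neg : ℕ → Lit

compl : Lit → Lit
compl (pos x) = neg x
compl (neg x) = pos x

-- A clause is a finite set of literals, represented by a list
-- (order and repetitions irrelevant: everything below is membership-based).
Clause : Set
Clause = List Lit

CNF : Set
CNF = List Clause

_≈ₛ_ : Clause → Clause → Set
c ≈ₛ d = ∀ l → (l ∈ c) ⇔ (l ∈ d)

_∈F_ : Clause → CNF → Set
c ∈F F = Any (λ d → d ≈ₛ c) F

Tautology : Clause → Set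
Tautology c = ∃ λ l → l ∈ c × compl l ∈ c

WellFormed : CNF → Set
WellFormed F = All (λ c → ¬ Tautology c) F

Assignment : Set
Assignment = ℕ → Bool

evalLit : Assignment → Lit → Bool
evalLit a (pos x) = a x
evalLit a (neg x) = not (a x)

SatClause : Assignment → Clause → Set
SatClause a c = Any (λ l → T (evalLit a l)) c

SatCNF : Assignment → CNF → Set
SatCNF a F = All (SatClause a) F

Equivalent : CNF → CNF → Set
Equivalent F G = ∀ a → SatCNF a F ⇔ SatCNF a G

IsResolvent : Clause → Clause → Lit → Clause → Set
IsResolvent c₁ c₂ l d =
  l ∈ c₁ × compl l ∈ c₂ × ¬ Tautology d ×
  (∀ x → (x ∈ d) ⇔ ((x ∈ c₁ × x ≢ l) ⊎ (x ∈ c₂ × x ≢ compl l)))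

-- Resolution closure ResCn(F), as a predicate on clauses (closed under set equality).
data ResCn (F : CNF) : Clause → Set where
  base : ∀ {c} → c ∈F F → ResCn F c
  step : ∀ {c₁ c₂ l d} → ResCn F c₁ → ResCn F c₂ →
         IsResolvent c₁ c₂ l d → ResCn F d

Superredundant : CNF → Clause → Set
Superredundant F c =
  ∀ a → (∀ d → ResCn F d → ¬ (d ≈ₛ c) → SatClause a d) → SatClause a c

Superirredundant : CNF → Clause → Set
Superirredundant F c = ¬ Superredundant F c

{-# OPTIONS --safe #-}
-- Let c be a non-tautological clause and l a literal whose variable does not
-- occur in c. In F = c ∧ (l ∨ c) ∧ (¬l ∨ c) the clause c is implied by the two
-- other members of ResCn(F), which split it on l, so it is superredundant.
-- In the equivalent F′ = c nothing resolves, so ResCn(F′) = {c} and c is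
-- superirredundant: removing it leaves no constraint at all, while a
-- non-tautological clause is falsified by some assignment.
module Submission where

open import Defs
open import Data.Bool using (true; false; T)
open import Data.Empty using (⊥-elim)
open import Data.List using ([]; _∷_)
open import Data.List.Membership.Propositional using (_∈_; _∉_; find)
open import Data.List.Relation.Unary.All using ([]; _∷_)
open import Data.List.Relation.Unary.Any using (here; there)
import Data.Nat.Properties as ℕ
open import Data.Product using (Σ; _×_; _,_)
open import Function.Bundles using (mk⇔; Equivalence)
import Function.Properties.Equivalence as ⇔
open import Relation.Binary.Definitions using (DecidableEquality)
open import Relation.Binary.PropositionalEquality using (_≡_; refl; sym; trans; cong; subst)
open import Relation.Nullary using (¬_; does; yes; no)
open import Relation.Nullary.Decidable using (map′)

open Equivalence using (to)

private
  variable
    a : Assignment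
    l : Lit
    c d : Clause

≈ₛ-refl : c ≈ₛ c
≈ₛ-refl _ = ⇔.refl

≈ₛ-sym : c ≈ₛ d → d ≈ₛ c
≈ₛ-sym c≈d m = ⇔.sym (c≈d m)

∷-≉ₛ : l ∉ c → ¬ (l ∷ c) ≈ₛ c
∷-≉ₛ l∉c l∷c≈c = l∉c (to (l∷c≈c _) (here refl))

pos-injective : ∀ {x y} → pos x ≡ pos y → x ≡ y
pos-injective refl = refl

neg-injective : ∀ {x y} → neg x ≡ neg y → x ≡ y
neg-injective refl = refl

_≟ᴸ_ : DecidableEquality Lit
pos x ≟ᴸ pos y = map′ (cong pos) pos-injective (x ℕ.≟ y)
neg x ≟ᴸ neg y = map′ (cong neg) neg-injective (x ℕ.≟ y)
pos x ≟ᴸ neg y = no λ ()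
neg x ≟ᴸ pos y = no λ ()

open import Data.List.Membership.DecPropositional _≟ᴸ_ using (_∈?_)

compl-involutive : ∀ l → compl (compl l) ≡ l
compl-involutive (pos x) = refl
compl-involutive (neg x) = refl

compl-≢ : ∀ l → ¬ compl l ≡ l
compl-≢ (pos x) ()
compl-≢ (neg x) ()

evalLit-compl : ∀ l → T (evalLit a l) → ¬ T (evalLit a (compl l))
evalLit-compl {a} (pos x) with a x
... | true  = λ _ ()
... | false = λ ()
evalLit-compl {a} (neg x) with a x
... | true  = λ ()
... | false = λ _ ()

¬Tautology-[] : ¬ Tautology []
¬Tautology-[] (_ , () , _)

¬Tautology-∷ : ¬ Tautology c → compl l ∉ c → ¬ Tautology (l ∷ c)
¬Tautology-∷ {l = l} _ _ (_ , here refl , here cl≡l) = compl-≢ l cl≡l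
¬Tautology-∷ _ cl∉c (_ , here refl , there cl∈c) = cl∉c cl∈c
¬Tautology-∷ {c} _ cl∉c (m , there m∈c , here cm≡l) =
  cl∉c (subst (_∈ c) (trans (sym (compl-involutive m)) (cong compl cm≡l)) m∈c)
¬Tautology-∷ ¬taut _ (m , there m∈c , there cm∈c) = ¬taut (m , m∈c , cm∈c)

-- Makes every literal of c false, which is consistent as long as c is no tautology.
falsifier : Clause → Assignment
falsifier c x = does (neg x ∈? c)

falsifier-falsifies-∈ : ¬ Tautology c → l ∈ c → ¬ T (evalLit (falsifier c) l)
falsifier-falsifies-∈ {c} {pos x} ¬taut px∈c t with neg x ∈? c
... | yes nx∈c = ¬taut (pos x , px∈c , nx∈c)
... | no _     = t
falsifier-falsifies-∈ {c} {neg x} _ nx∈c t with neg x ∈? c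
... | yes _   = t
... | no nx∉c = nx∉c nx∈c

falsifier-falsifies : ¬ Tautology c → ¬ SatClause (falsifier c) c
falsifier-falsifies ¬taut sat with find sat
... | _ , l∈c , t = falsifier-falsifies-∈ ¬taut l∈c t

ResCn-[_]-≈ₛ : ¬ Tautology c → ResCn (c ∷ []) d → d ≈ₛ c
ResCn-[ _ ]-≈ₛ (base (here d≈c)) = ≈ₛ-sym d≈c
ResCn-[ ¬taut ]-≈ₛ (step r₁ r₂ (l∈c₁ , cl∈c₂ , _)) = ⊥-elim
  (¬taut (_ , to (ResCn-[ ¬taut ]-≈ₛ r₁ _) l∈c₁ , to (ResCn-[ ¬taut ]-≈ₛ r₂ _) cl∈c₂))

superirredundant-[_] : ¬ Tautology c → Superirredundant (c ∷ []) c
superirredundant-[_] {c} ¬taut superred =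
  falsifier-falsifies ¬taut
    (superred (falsifier c) λ _ r d≉c → ⊥-elim (d≉c (ResCn-[ ¬taut ]-≈ₛ r)))

superredundant-split : ∀ {F} → l ∉ c → compl l ∉ c →
  (l ∷ c) ∈F F → (compl l ∷ c) ∈F F → Superredundant F c
superredundant-split {l} l∉c cl∉c l∷c∈F cl∷c∈F a sat-others
  with sat-others _ (base l∷c∈F) (∷-≉ₛ l∉c) | sat-others _ (base cl∷c∈F) (∷-≉ₛ cl∉c)
... | there sat | _         = sat
... | _         | there sat = sat
... | here t    | here u    = ⊥-elim (evalLit-compl l t u)

splitting : Clause → Lit → CNF
splitting c l = c ∷ (l ∷ c) ∷ (compl l ∷ c) ∷ []

splitting-wellFormed : ¬ Tautology c → l ∉ c → compl l ∉ c → WellFormed (splitting c l)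
splitting-wellFormed {c} {l} ¬taut l∉c cl∉c =
  ¬taut ∷ ¬Tautology-∷ ¬taut cl∉c ∷
  ¬Tautology-∷ ¬taut (subst (_∉ c) (sym (compl-involutive l)) l∉c) ∷ []

splitting-equivalent : Equivalent (splitting c l) (c ∷ [])
splitting-equivalent _ = mk⇔ (λ { (sat ∷ _) → sat ∷ [] })
                             (λ { (sat ∷ []) → sat ∷ there sat ∷ there sat ∷ [] })

c₀ : Clause
c₀ = pos 0 ∷ pos 1 ∷ []

¬Tautology-c₀ : ¬ Tautology c₀
¬Tautology-c₀ = ¬Tautology-∷ (¬Tautology-∷ ¬Tautology-[] λ ()) λ { (here ()) ; (there ()) }

pos2∉c₀ : pos 2 ∉ c₀
pos2∉c₀ (there (there ()))

neg2∉c₀ : neg 2 ∉ c₀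
neg2∉c₀ (there (there ()))

lemma3 : Σ CNF λ F → Σ CNF λ F′ → Σ Clause λ c →
    WellFormed F × WellFormed F′ × Equivalent F F′ ×
    c ∈F F × c ∈F F′ × Superredundant F c × Superirredundant F′ c
lemma3 =
  splitting c₀ (pos 2) , c₀ ∷ [] , c₀ ,
  splitting-wellFormed ¬Tautology-c₀ pos2∉c₀ neg2∉c₀ ,
  ¬Tautology-c₀ ∷ [] ,
  splitting-equivalent ,
  here ≈ₛ-refl , here ≈ₛ-refl ,
  superredundant-split pos2∉c₀ neg2∉c₀ (there (here ≈ₛ-refl)) (there (there (here ≈ₛ-refl))) ,
  superirredundant-[ ¬Tautology-c₀ ]
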